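{- Let $\mathrm{XORUnification}$ be the XOR-unification algorithm described in the context. For every unification problem $P$, if $P$ is not unifiable (no substitution solves $P$), then $\mathrm{XORUnification}(P)$ returns None.
   Context: Terms are built from constants $C(n)$ ($n\in\mathbb{N}$), variables (indexed by strings), and a binary operator $\oplus$; the constant $0:=C(0)$ is the unit. The relation $\approx_{XOR}$ is the smallest congruence on terms (reflexive, symmetric, transitive, compatible with $\oplus$) containing associativity $(x\oplus y)\oplus z\approx x\oplus(y\oplus z)$, commutativity $x\oplus y\approx y\oplus x$, unity $0\oplus x\approx x$ and nilpotency $x\oplus x\approx 0$. A substitution maps variables to terms (identity on all but finitely many) and is extended homomorphically to terms. A unification problem is a finite list of equations $s\approx^? t$; a substitution solves it if $\sigma(s)\approx_{XOR}\sigma(t)$ for each equation. The algorithm $\mathrm{XORUnification}$: each equation $s\approx^?t$ is rewritten as $s\oplus t\approx^?0$ and the left side is put in a normal form modulo $\approx_{XOR}$ (a list of atoms with cancelled duplicate pairs and removed $0$'s); one starts with the pair $\Gamma\|\Lambda$ with $\Gamma$ these equations and $\Lambda=\emptyset$, and repeatedly applies the first applicable of the rules (Trivial) $\Gamma\cup\{0\approx^?0\}\|\Lambda\ \Rightarrow\ \Gamma\|\Lambda$ and (Variable Substitution) $\Gamma\cup\{x\oplus S\approx^?0\}\|\Lambda\ \Rightarrow\ \sigma\Gamma\|\sigma\Lambda\cup\{x\approx^?S\}$, where $x$ is a variable not occurring in $S$ and $\sigma=\{x\mapsto S\}$ (results re-normalized). When no rule applies, if $\Gamma$ is empty the algorithm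 returns the substitution $\{x\mapsto S : (x\approx^?S)\in\Lambda\}$, and otherwise returns None. -}

module Defs where

open import Data.Nat using (ℕ; zero; suc)
import Data.Nat as ℕ
open import Data.String using (String)
import Data.String as Str
open import Data.List using (List; []; _∷_; _++_; map; foldl; length)
open import Data.List.Relation.Unary.All using (All)
open import Data.Product using (_×_; _,_; Σ; ∃)
open import Data.Maybe using (Maybe; just; nothing)
open import Relation.Nullary using (¬_; Dec; yes; no)
open import Relation.Binary.PropositionalEquality using (_≡_; refl; cong)

infixl 6 _⊕_

data Term : Set where
  C   : ℕ → Term          -- constants C(n); C 0 is the unit 0
  V   : String → Term
  _⊕_ : Term → Term → Term

𝟘 : Term
𝟘 = C 0

infix 4 _≈X_
data _≈X_ : Term → Term → Set where
  ≈refl  : ∀ {s} → s ≈X s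
  ≈sym   : ∀ {s t} → s ≈X t → t ≈X s
  ≈trans : ∀ {s t u} → s ≈X t → t ≈X u → s ≈X u
  ≈cong  : ∀ {s s' t t'} → s ≈X s' → t ≈X t' → (s ⊕ t) ≈X (s' ⊕ t')
  ≈assoc : ∀ x y z → ((x ⊕ y) ⊕ z) ≈X (x ⊕ (y ⊕ z))
  ≈comm  : ∀ x y → (x ⊕ y) ≈X (y ⊕ x)
  ≈unit  : ∀ x → (𝟘 ⊕ x) ≈X x
  ≈nil   : ∀ x → (x ⊕ x) ≈X 𝟘

Subst : Set
Subst = List (String × Term)

lookupS : Subst → String → Term
lookupS [] x = V x
lookupS ((y , t) ∷ σ) x with x Str.≟ y
... | yes _ = t
... | no  _ = lookupS σ x

apply : Subst → Term → Term
apply σ (C n)   = C n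
apply σ (V x)   = lookupS σ x
apply σ (s ⊕ t) = apply σ s ⊕ apply σ t

Equation : Set
Equation = Term × Term

Problem : Set
Problem = List Equation

Solves : Subst → Problem → Set
Solves σ P = All (λ e → apply σ (Data.Product.proj₁ e) ≈X apply σ (Data.Product.proj₂ e)) P

Unifiable : Problem → Set
Unifiable P = Σ Subst (λ σ → Solves σ P)

-- Normal forms: lists of atoms (no C 0, duplicate pairs cancelled)

data Atom : Set where
  aC : ℕ → Atom
  aV : String → Atom

_≟A_ : (a b : Atom) → Dec (a ≡ b)
aC m ≟A aC n with m ℕ.≟ n
... | yes refl = yes refl
... | no  m≢n  = no λ { refl → m≢n refl }
aC _ ≟A aV _ = no λ ()
aV _ ≟A aC _ = no λ ()
aV x ≟A aV y with x Str.≟ y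
... | yes refl = yes refl
... | no  x≢y  = no λ { refl → x≢y refl }

flatten : Term → List Atom
flatten (C zero)    = []
flatten (C (suc n)) = aC (suc n) ∷ []
flatten (V x)       = aV x ∷ []
flatten (s ⊕ t)     = flatten s ++ flatten t

toggle : List Atom → Atom → List Atom
toggle [] a = a ∷ []
toggle (b ∷ bs) a with a ≟A b
... | yes _ = bs
... | no  _ = b ∷ toggle bs a

norm : Term → List Atom
norm t = foldl toggle [] (flatten t)

atomTerm : Atom → Term
atomTerm (aC n) = C n
atomTerm (aV x) = V x

fromAtoms : List Atom → Term
fromAtoms []           = 𝟘
fromAtoms (a ∷ [])     = atomTerm a
fromAtoms (a ∷ b ∷ as) = atomTerm a ⊕ fromAtoms (b ∷ as)

-- The algorithm.  An equation S ≈? 0 is stored as its normalized atom list S.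

NEq : Set
NEq = List Atom

findTrivial : List NEq → Maybe (List NEq)
findTrivial [] = nothing
findTrivial ([] ∷ Γ) = just Γ
findTrivial (e ∷ Γ) with findTrivial Γ
... | just Γ' = just (e ∷ Γ')
... | nothing = nothing

firstVar : List Atom → Maybe (String × List Atom)
firstVar [] = nothing
firstVar (aV x ∷ as) = just (x , as)
firstVar (aC n ∷ as) with firstVar as
... | just (x , S) = just (x , aC n ∷ S)
... | nothing = nothing

-- first equation x ⊕ S ≈? 0 of Γ (x not in S holds automatically in a
-- normal form, since atoms are pairwise distinct); returns x, S, rest of Γ
findVar : List NEq → Maybe (String × List Atom × List NEq)
findVar [] = nothing
findVar (e ∷ Γ) with firstVar e
... | just (x , S) = just (x , S , Γ)
... | nothing with findVar Γ
...   | just (x , S , Γ') = just (x , S , e ∷ Γ')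
...   | nothing = nothing

finish : List NEq → Subst → Maybe Subst
finish [] Λ = just Λ
finish (_ ∷ _) Λ = nothing

-- fuel = |Γ|; each rule application removes one equation from Γ
run : ℕ → List NEq → Subst → Maybe Subst
run zero Γ Λ = finish Γ Λ
run (suc n) Γ Λ with findTrivial Γ
... | just Γ' = run n Γ' Λ
... | nothing with findVar Γ
...   | nothing = finish Γ Λ
...   | just (x , S , Γ') =
          run n (map (λ e → norm (apply σ (fromAtoms e))) Γ')
                (map (λ b → Data.Product.proj₁ b , apply σ (Data.Product.proj₂ b)) Λ
                   ++ ((x , fromAtoms S) ∷ []))
  where σ : Subst
        σ = (x , fromAtoms S) ∷ []

initial : Problem → List NEq
initial P = map (λ e → norm (Data.Product.proj₁ e ⊕ Data.Product.proj₂ e)) P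

XORUnification : Problem → Maybe Subst
XORUnification P = run (length (initial P)) (initial P) []

{-# OPTIONS --safe #-}
-- The algorithm is sound, by an invariant of the run: whenever θ solves the
-- current equations Γ, θ composed with the accumulated Λ solves P. Initially
-- this holds because normalisation preserves ≈XOR and s ⊕ t ≈ 0 means s ≈ t;
-- dropping 0 ≈? 0 keeps it. For an elimination of x ⊕ S ≈? 0 with
-- σ = {x ↦ S}, a solution θ of σΓ gives the solution θσ of Γ, because σ
-- itself unifies x ⊕ S: x does not occur in S, so σ(x ⊕ S) = S ⊕ S ≈ 0.
-- When Γ is empty the identity solves it, so any returned substitution
-- solves P.
module Submission where

open import Defs
open import Algebra.Bundles using (AbelianGroup)
open import Algebra.Structures using (IsAbelianGroup)
import Algebra.Properties.AbelianGroup as AbelianGroupProperties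
import Algebra.Properties.CommutativeSemigroup as CommutativeSemigroupProperties
import Relation.Binary.Reasoning.Setoid as SetoidReasoning
open import Data.Empty using (⊥-elim)
open import Data.List using (List; []; _∷_; _++_; map; foldl; length)
open import Data.List.Relation.Unary.All as All using (All; []; _∷_)
import Data.List.Relation.Unary.All.Properties as All
open import Data.List.Relation.Unary.AllPairs using ([]; _∷_)
open import Data.List.Relation.Unary.Unique.Propositional using (Unique)
open import Data.List.Relation.Binary.Permutation.Propositional
  using (_↭_; ↭-refl; ↭-prep; ↭-swap; ↭-trans; ↭-sym)
open import Data.List.Relation.Binary.Permutation.Propositional.Properties
  using (All-resp-↭)
open import Data.Maybe using (just; nothing)
open import Data.Nat using (zero; suc)
open import Data.Product using (_×_; _,_; ∃; map₂)
open import Data.String using (String)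
import Data.String as String
open import Function using (id)
open import Relation.Nullary using (¬_; yes; no)
open import Relation.Binary.PropositionalEquality
  using (_≡_; _≢_; refl; sym; trans; cong; cong₂; subst₂; module ≡-Reasoning)

⊕-isAbelianGroup : IsAbelianGroup _≈X_ _⊕_ 𝟘 id
⊕-isAbelianGroup = record
  { isGroup = record
    { isMonoid = record
      { isSemigroup = record
        { isMagma = record
          { isEquivalence = record { refl = ≈refl ; sym = ≈sym ; trans = ≈trans }
          ; ∙-cong = ≈cong
          }
        ; assoc = ≈assoc
        }
      ; identity = ≈unit , λ x → ≈trans (≈comm x 𝟘) (≈unit x)
      }
    ; inverse = ≈nil , ≈nil
    ; ⁻¹-cong = id
    }
  ; comm = ≈comm
  }

⊕-abelianGroup : AbelianGroup _ _
⊕-abelianGroup = record { isAbelianGroup = ⊕-isAbelianGroup }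

open AbelianGroup ⊕-abelianGroup using (setoid; ∙-congˡ; identityʳ)
open AbelianGroupProperties ⊕-abelianGroup using (inverseˡ-unique; xyx⁻¹≈y)
open CommutativeSemigroupProperties (AbelianGroup.commutativeSemigroup ⊕-abelianGroup)
  using (x∙yz≈y∙xz)
module ≈X-Reasoning = SetoidReasoning setoid

apply-resp-≈X : ∀ θ {s t} → s ≈X t → apply θ s ≈X apply θ t
apply-resp-≈X θ ≈refl          = ≈refl
apply-resp-≈X θ (≈sym p)       = ≈sym (apply-resp-≈X θ p)
apply-resp-≈X θ (≈trans p q)   = ≈trans (apply-resp-≈X θ p) (apply-resp-≈X θ q)
apply-resp-≈X θ (≈cong p q)    = ≈cong (apply-resp-≈X θ p) (apply-resp-≈X θ q)
apply-resp-≈X θ (≈assoc _ _ _) = ≈assoc _ _ _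
apply-resp-≈X θ (≈comm _ _)    = ≈comm _ _
apply-resp-≈X θ (≈unit _)      = ≈unit _
apply-resp-≈X θ (≈nil _)       = ≈nil _

apply-identity : ∀ t → apply [] t ≡ t
apply-identity (C n)   = refl
apply-identity (V x)   = refl
apply-identity (s ⊕ t) = cong₂ _⊕_ (apply-identity s) (apply-identity t)

Solves-resp-≗ : ∀ {σ τ} P → (∀ t → apply σ t ≡ apply τ t) → Solves σ P → Solves τ P
Solves-resp-≗ P σ≗τ = All.map λ {(s , t)} → subst₂ _≈X_ (σ≗τ s) (σ≗τ t)

infixr 9 _∘ˢ_
_∘ˢ_ : Subst → Subst → Subst
θ ∘ˢ Λ = map (map₂ (apply θ)) Λ ++ θ

lookupS-∘ˢ : ∀ θ Λ x → lookupS (θ ∘ˢ Λ) x ≡ apply θ (lookupS Λ x)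
lookupS-∘ˢ θ []            x = refl
lookupS-∘ˢ θ ((y , t) ∷ Λ) x with x String.≟ y
... | yes _ = refl
... | no  _ = lookupS-∘ˢ θ Λ x

apply-∘ˢ : ∀ θ Λ t → apply (θ ∘ˢ Λ) t ≡ apply θ (apply Λ t)
apply-∘ˢ θ Λ (C n)   = refl
apply-∘ˢ θ Λ (V x)   = lookupS-∘ˢ θ Λ x
apply-∘ˢ θ Λ (s ⊕ t) = cong₂ _⊕_ (apply-∘ˢ θ Λ s) (apply-∘ˢ θ Λ t)

apply-∘ˢ-assoc : ∀ θ σ Λ t → apply ((θ ∘ˢ σ) ∘ˢ Λ) t ≡ apply (θ ∘ˢ σ ∘ˢ Λ) t
apply-∘ˢ-assoc θ σ Λ t = begin
  apply ((θ ∘ˢ σ) ∘ˢ Λ) t       ≡⟨ apply-∘ˢ (θ ∘ˢ σ) Λ t ⟩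
  apply (θ ∘ˢ σ) (apply Λ t)    ≡⟨ apply-∘ˢ θ σ (apply Λ t) ⟩
  apply θ (apply σ (apply Λ t)) ≡⟨ cong (apply θ) (apply-∘ˢ σ Λ t) ⟨
  apply θ (apply (σ ∘ˢ Λ) t)    ≡⟨ apply-∘ˢ θ (σ ∘ˢ Λ) t ⟨
  apply (θ ∘ˢ σ ∘ˢ Λ) t         ∎
  where open ≡-Reasoning

_↦_ : String → Term → Subst
x ↦ T = (x , T) ∷ []

lookupS-↦ : ∀ x T → lookupS (x ↦ T) x ≡ T
lookupS-↦ x T with x String.≟ x
... | yes _   = refl
... | no  x≢x = ⊥-elim (x≢x refl)

apply-↦-atomTerm : ∀ x T {a} → aV x ≢ a → apply (x ↦ T) (atomTerm a) ≡ atomTerm a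
apply-↦-atomTerm x T {aC n} _ = refl
apply-↦-atomTerm x T {aV y} x≢y with y String.≟ x
... | yes refl = ⊥-elim (x≢y refl)
... | no  _    = refl

apply-↦-fromAtoms : ∀ x T {as} → All (aV x ≢_) as → apply (x ↦ T) (fromAtoms as) ≡ fromAtoms as
apply-↦-fromAtoms x T []                   = refl
apply-↦-fromAtoms x T (x≢a ∷ [])           = apply-↦-atomTerm x T x≢a
apply-↦-fromAtoms x T (x≢a ∷ x≢as@(_ ∷ _)) =
  cong₂ _⊕_ (apply-↦-atomTerm x T x≢a) (apply-↦-fromAtoms x T x≢as)

fromAtoms-∷ : ∀ a as → fromAtoms (a ∷ as) ≈X atomTerm a ⊕ fromAtoms as
fromAtoms-∷ a []      = ≈sym (identityʳ (atomTerm a))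
fromAtoms-∷ a (_ ∷ _) = ≈refl

fromAtoms-++ : ∀ as bs → fromAtoms (as ++ bs) ≈X fromAtoms as ⊕ fromAtoms bs
fromAtoms-++ []       bs = ≈sym (≈unit (fromAtoms bs))
fromAtoms-++ (a ∷ as) bs = begin
  fromAtoms (a ∷ as ++ bs)                   ≈⟨ fromAtoms-∷ a (as ++ bs) ⟩
  atomTerm a ⊕ fromAtoms (as ++ bs)          ≈⟨ ∙-congˡ (fromAtoms-++ as bs) ⟩
  atomTerm a ⊕ (fromAtoms as ⊕ fromAtoms bs) ≈⟨ ≈assoc _ _ _ ⟨
  atomTerm a ⊕ fromAtoms as ⊕ fromAtoms bs   ≈⟨ ≈cong (fromAtoms-∷ a as) ≈refl ⟨
  fromAtoms (a ∷ as) ⊕ fromAtoms bs          ∎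
  where open ≈X-Reasoning

fromAtoms-toggle : ∀ as a → fromAtoms (toggle as a) ≈X fromAtoms as ⊕ atomTerm a
fromAtoms-toggle []       a = ≈sym (≈unit (atomTerm a))
fromAtoms-toggle (b ∷ bs) a with a ≟A b
... | yes refl = begin
  fromAtoms bs                             ≈⟨ xyx⁻¹≈y (atomTerm a) (fromAtoms bs) ⟨
  atomTerm a ⊕ fromAtoms bs ⊕ atomTerm a   ≈⟨ ≈cong (fromAtoms-∷ a bs) ≈refl ⟨
  fromAtoms (a ∷ bs) ⊕ atomTerm a          ∎
  where open ≈X-Reasoning
... | no _ = begin
  fromAtoms (b ∷ toggle bs a)              ≈⟨ fromAtoms-∷ b (toggle bs a) ⟩
  atomTerm b ⊕ fromAtoms (toggle bs a)     ≈⟨ ∙-congˡ (fromAtoms-toggle bs a) ⟩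
  atomTerm b ⊕ (fromAtoms bs ⊕ atomTerm a) ≈⟨ ≈assoc _ _ _ ⟨
  atomTerm b ⊕ fromAtoms bs ⊕ atomTerm a   ≈⟨ ≈cong (fromAtoms-∷ b bs) ≈refl ⟨
  fromAtoms (b ∷ bs) ⊕ atomTerm a          ∎
  where open ≈X-Reasoning

fromAtoms-foldl-toggle : ∀ acc as →
  fromAtoms (foldl toggle acc as) ≈X fromAtoms acc ⊕ fromAtoms as
fromAtoms-foldl-toggle acc []       = ≈sym (identityʳ (fromAtoms acc))
fromAtoms-foldl-toggle acc (a ∷ as) = begin
  fromAtoms (foldl toggle (toggle acc a) as)  ≈⟨ fromAtoms-foldl-toggle (toggle acc a) as ⟩
  fromAtoms (toggle acc a) ⊕ fromAtoms as     ≈⟨ ≈cong (fromAtoms-toggle acc a) ≈refl ⟩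
  fromAtoms acc ⊕ atomTerm a ⊕ fromAtoms as   ≈⟨ ≈assoc _ _ _ ⟩
  fromAtoms acc ⊕ (atomTerm a ⊕ fromAtoms as) ≈⟨ ∙-congˡ (fromAtoms-∷ a as) ⟨
  fromAtoms acc ⊕ fromAtoms (a ∷ as)          ∎
  where open ≈X-Reasoning

fromAtoms-flatten : ∀ t → fromAtoms (flatten t) ≈X t
fromAtoms-flatten (C zero)    = ≈refl
fromAtoms-flatten (C (suc n)) = ≈refl
fromAtoms-flatten (V x)       = ≈refl
fromAtoms-flatten (s ⊕ t)     =
  ≈trans (fromAtoms-++ (flatten s) (flatten t)) (≈cong (fromAtoms-flatten s) (fromAtoms-flatten t))

fromAtoms-norm : ∀ t → fromAtoms (norm t) ≈X t
fromAtoms-norm t = begin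
  fromAtoms (foldl toggle [] (flatten t)) ≈⟨ fromAtoms-foldl-toggle [] (flatten t) ⟩
  𝟘 ⊕ fromAtoms (flatten t)               ≈⟨ ≈unit _ ⟩
  fromAtoms (flatten t)                   ≈⟨ fromAtoms-flatten t ⟩
  t                                       ∎
  where open ≈X-Reasoning

solves-norm : ∀ θ t → apply θ (fromAtoms (norm t)) ≈X 𝟘 → apply θ t ≈X 𝟘
solves-norm θ t = ≈trans (apply-resp-≈X θ (≈sym (fromAtoms-norm t)))

toggle-All : ∀ {P : Atom → Set} {a} as → P a → All P as → All P (toggle as a)
toggle-All []       pa []         = pa ∷ []
toggle-All {a = a} (b ∷ bs) pa (pb ∷ pbs) with a ≟A b
... | yes _ = pbs
... | no  _ = pb ∷ toggle-All bs pa pbs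

toggle-unique : ∀ as a → Unique as → Unique (toggle as a)
toggle-unique []       a []           = [] ∷ []
toggle-unique (b ∷ bs) a (b∉bs ∷ bs!) with a ≟A b
... | yes _   = bs!
... | no  a≢b = toggle-All bs (λ b≡a → a≢b (sym b≡a)) b∉bs ∷ toggle-unique bs a bs!

norm-unique : ∀ t → Unique (norm t)
norm-unique t = go [] (flatten t) []
  where
  go : ∀ acc as → Unique acc → Unique (foldl toggle acc as)
  go acc []       acc! = acc!
  go acc (a ∷ as) acc! = go (toggle acc a) as (toggle-unique acc a acc!)

firstVar-sound : ∀ e {x S} → firstVar e ≡ just (x , S) → fromAtoms e ≈X V x ⊕ fromAtoms S
firstVar-sound (aV y ∷ as) refl = fromAtoms-∷ (aV y) as
firstVar-sound (aC n ∷ as) eq with firstVar as in eq′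
firstVar-sound (aC n ∷ as) refl | just (x , S) = begin
  fromAtoms (aC n ∷ as)      ≈⟨ fromAtoms-∷ (aC n) as ⟩
  C n ⊕ fromAtoms as         ≈⟨ ∙-congˡ (firstVar-sound as eq′) ⟩
  C n ⊕ (V x ⊕ fromAtoms S)  ≈⟨ x∙yz≈y∙xz (C n) (V x) (fromAtoms S) ⟩
  V x ⊕ (C n ⊕ fromAtoms S)  ≈⟨ ∙-congˡ (fromAtoms-∷ (aC n) S) ⟨
  V x ⊕ fromAtoms (aC n ∷ S) ∎
  where open ≈X-Reasoning

firstVar-fresh : ∀ {e x S} → Unique e → firstVar e ≡ just (x , S) → All (aV x ≢_) S
firstVar-fresh {aV y ∷ as} (y∉as ∷ _) refl = y∉as
firstVar-fresh {aC n ∷ as} (_ ∷ as!) eq with firstVar as in eq′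
firstVar-fresh {aC n ∷ as} (_ ∷ as!) refl | just _ = (λ ()) ∷ firstVar-fresh as! eq′

firstVar-unifies : ∀ {e x S} → Unique e → firstVar e ≡ just (x , S) →
  apply (x ↦ fromAtoms S) (fromAtoms e) ≈X 𝟘
firstVar-unifies {e} {x} {S} e! eq = begin
  apply σ (fromAtoms e)               ≈⟨ apply-resp-≈X σ (firstVar-sound e eq) ⟩
  lookupS σ x ⊕ apply σ (fromAtoms S) ≡⟨ cong₂ _⊕_ (lookupS-↦ x (fromAtoms S))
                                                  (apply-↦-fromAtoms x (fromAtoms S) (firstVar-fresh e! eq)) ⟩
  fromAtoms S ⊕ fromAtoms S           ≈⟨ ≈nil (fromAtoms S) ⟩
  𝟘                                   ∎
  where
  σ = x ↦ fromAtoms S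
  open ≈X-Reasoning

findTrivial-↭ : ∀ Γ {Γ′} → findTrivial Γ ≡ just Γ′ → Γ ↭ [] ∷ Γ′
findTrivial-↭ ([] ∷ Γ)      refl = ↭-refl
findTrivial-↭ ((a ∷ e) ∷ Γ) eq with findTrivial Γ in eq′
findTrivial-↭ ((a ∷ e) ∷ Γ) refl | just _ =
  ↭-trans (↭-prep (a ∷ e) (findTrivial-↭ Γ eq′)) (↭-swap (a ∷ e) [] ↭-refl)

findVar-↭ : ∀ Γ {x S Γ′} → findVar Γ ≡ just (x , S , Γ′) →
  ∃ λ e → firstVar e ≡ just (x , S) × Γ ↭ e ∷ Γ′
findVar-↭ (e ∷ Γ) eq with firstVar e in eq′
findVar-↭ (e ∷ Γ) refl | just _ = e , eq′ , ↭-refl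
... | nothing with findVar Γ in eq″
findVar-↭ (e ∷ Γ) refl | nothing | just _ with findVar-↭ Γ eq″
... | e′ , eq‴ , Γ↭ = e′ , eq‴ , ↭-trans (↭-prep e Γ↭) (↭-swap e e′ ↭-refl)

SolvesNEqs : Subst → List NEq → Set
SolvesNEqs θ Γ = All (λ e → apply θ (fromAtoms e) ≈X 𝟘) Γ

Lifts : Problem → List NEq → Subst → Set
Lifts P Γ Λ = ∀ θ → SolvesNEqs θ Γ → Solves (θ ∘ˢ Λ) P

initial-unique : ∀ P → All Unique (initial P)
initial-unique P = All.map⁺ (All.universal (λ (s , t) → norm-unique (s ⊕ t)) P)

initial-lifts : ∀ P → Lifts P (initial P) []
initial-lifts P θ θ⊨Γ =
  All.map (λ {(s , t)} θ⊨s⊕t → inverseˡ-unique _ _ (solves-norm θ (s ⊕ t) θ⊨s⊕t)) (All.map⁻ θ⊨Γ)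

findTrivial-lifts : ∀ {P Γ Γ′ Λ} → findTrivial Γ ≡ just Γ′ → Lifts P Γ Λ → Lifts P Γ′ Λ
findTrivial-lifts {Γ = Γ} eq lifts θ θ⊨Γ′ =
  lifts θ (All-resp-↭ (↭-sym (findTrivial-↭ Γ eq)) (≈refl ∷ θ⊨Γ′))

substNEq : Subst → NEq → NEq
substNEq σ e = norm (apply σ (fromAtoms e))

solves-substNEq : ∀ θ σ e →
  apply θ (fromAtoms (substNEq σ e)) ≈X 𝟘 → apply (θ ∘ˢ σ) (fromAtoms e) ≈X 𝟘
solves-substNEq θ σ e θ⊨σe rewrite apply-∘ˢ θ σ (fromAtoms e) =
  solves-norm θ (apply σ (fromAtoms e)) θ⊨σe

substNEqs-unique : ∀ σ Γ → All Unique (map (substNEq σ) Γ)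
substNEqs-unique σ Γ = All.map⁺ (All.universal (λ e → norm-unique (apply σ (fromAtoms e))) Γ)

solves-substNEqs : ∀ θ σ Γ → SolvesNEqs θ (map (substNEq σ) Γ) → SolvesNEqs (θ ∘ˢ σ) Γ
solves-substNEqs θ σ []      []            = []
solves-substNEqs θ σ (e ∷ Γ) (θ⊨σe ∷ θ⊨σΓ) =
  solves-substNEq θ σ e θ⊨σe ∷ solves-substNEqs θ σ Γ θ⊨σΓ

findVar-lifts : ∀ {P Γ Λ x S Γ′} →
  findVar Γ ≡ just (x , S , Γ′) → All Unique Γ → Lifts P Γ Λ →
  Lifts P (map (substNEq (x ↦ fromAtoms S)) Γ′) ((x ↦ fromAtoms S) ∘ˢ Λ)
findVar-lifts {P} {Γ} {Λ} {x} {S} {Γ′} eq Γ! lifts θ θ⊨σΓ′ with findVar-↭ Γ eq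
... | e , e-first , Γ↭ =
  Solves-resp-≗ P (apply-∘ˢ-assoc θ σ Λ)
    (lifts (θ ∘ˢ σ) (All-resp-↭ (↭-sym Γ↭) (θσ⊨e ∷ solves-substNEqs θ σ Γ′ θ⊨σΓ′)))
  where
  σ = x ↦ fromAtoms S
  θσ⊨e : apply (θ ∘ˢ σ) (fromAtoms e) ≈X 𝟘
  θσ⊨e rewrite apply-∘ˢ θ σ (fromAtoms e) =
    apply-resp-≈X θ (firstVar-unifies (All.head (All-resp-↭ Γ↭ Γ!)) e-first)

finish-sound : ∀ {P} Γ {Λ Λ′} → Lifts P Γ Λ → finish Γ Λ ≡ just Λ′ → Solves Λ′ P
finish-sound {P} [] {Λ} lifts refl =
  Solves-resp-≗ P (λ t → trans (apply-∘ˢ [] Λ t) (apply-identity (apply Λ t))) (lifts [] [])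

run-sound : ∀ {P} n Γ Λ {Λ′} → All Unique Γ → Lifts P Γ Λ → run n Γ Λ ≡ just Λ′ → Solves Λ′ P
run-sound zero    Γ Λ Γ! lifts eq = finish-sound Γ lifts eq
run-sound (suc n) Γ Λ Γ! lifts eq with findTrivial Γ in trivial
... | just Γ′ = run-sound n Γ′ Λ (All.tail (All-resp-↭ (findTrivial-↭ Γ trivial) Γ!))
                          (findTrivial-lifts trivial lifts) eq
... | nothing with findVar Γ in eliminable
...   | nothing           = finish-sound Γ lifts eq
...   | just (x , S , Γ′) =
  run-sound n _ _ (substNEqs-unique (x ↦ fromAtoms S) Γ′) (findVar-lifts eliminable Γ! lifts) eq

XORUnification-sound : ∀ P {σ} → XORUnification P ≡ just σ → Solves σ P
XORUnification-sound P =
  run-sound (length (initial P)) (initial P) [] (initial-unique P) (initial-lifts P)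

mainTheorem5 : (P : Problem) → ¬ Unifiable P → XORUnification P ≡ nothing
mainTheorem5 P ¬unifiable with XORUnification P in eq
... | nothing = refl
... | just σ  = ⊥-elim (¬unifiable (σ , XORUnification-sound P eq))
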